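{- Let $p\ge5$ be a prime. Then: (1) for every odd $i$ with $0 < i < p-1$, the entry $(i,i)$ of $F(p,-2)$ is zero; (2) for every odd $i$ with $0 < i < p-1$, the entry $(i,p-1-i)$ of $F(p,-2^{ -1})$ is zero; (3) for every even $i$ with $0\le i\le p-1$, the entry $(i,i)$ of $F(p,-2)$ and the entry $(i,p-1-i)$ of $F(p,-2^{ -1})$ are nonzero.
   Context: For $m\in\mathbb{F}_p$, $F(p,m) = (a_{i,j})_{0\le i,j\le p-1}$ is the $p\times p$ matrix over $\mathbb{F}_p$ with $a_{i,0} = a_{0,j}=1$ and $a_{i,j} = a_{i-1,j} + m\,a_{i-1,j-1} + a_{i,j-1}$ for $i,j\ge1$. Here $-2$ and $-2^{ -1}$ are elements of $\mathbb{F}_p$. -}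

module Defs where

open import Data.Nat using (ℕ; zero; suc; _+_; _*_)
open import Data.Nat.DivMod using (_%_)

-- reduction modulo p (only used for p ≥ 5 in the statement; for p = 0 it is the identity)
_mod_ : ℕ → ℕ → ℕ
x mod zero    = x
x mod (suc q) = x % suc q

-- Elements of 𝔽_p are represented by natural numbers reduced modulo p.
-- F p m i j  is the (i,j) entry of the matrix F(p,m) over 𝔽_p, computed via
--   a(i,0) = a(0,j) = 1,
--   a(i,j) = a(i-1,j) + m a(i-1,j-1) + a(i,j-1)   (mod p).
F : ℕ → ℕ → ℕ → ℕ → ℕ
F p m zero    j       = 1 mod p
F p m (suc i) zero    = 1 mod p
F p m (suc i) (suc j) = (F p m i (suc j) + m * F p m i j + F p m (suc i) j) mod p

module Submission where

-- Over ℤ, the recurrence defining F(p, m) is solved by the coefficient of tʲ in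
-- (1 + (1+m)t)ⁱ (1 + t)ʲ.  For m = -2 the diagonal entry is the coefficient of tⁱ in
-- (1 - t)ⁱ (1 + t)ⁱ = (1 - t²)ⁱ: zero for odd i and ±C(i, i/2) for even i, which p does not
-- divide since i < p.  For 2m ≡ -1 we have 2ⁱ (1 + (1+m)t)ⁱ ≡ (1 + (1+t))ⁱ, so 2ⁱ times the
-- (i, j) entry is ∑ₖ C(i,k) C(k+j, k); on the antidiagonal i + j = p - 1 each C(k+j, k) is
-- ≡ (-1)ᵏ C(i,k), and the sum becomes ∑ₖ (-1)ᵏ C(i,k)², the same coefficient of (1 - t²)ⁱ.

open import Defs

module IntegerModel where

  open import Data.Empty using (⊥-elim)
  open import Data.Fin as Fin using (Fin; toℕ)
  open import Data.Fin.Properties using (toℕ<n)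
  open import Data.Integer as ℤ using (ℤ; +_; _+_; _*_; -_; _-_; 0ℤ; 1ℤ; -1ℤ; _^_; ∣_∣)
  import Data.Integer.Properties as ℤ
  open import Algebra.Properties.Semiring.Sum ℤ.+-*-semiring
    using (sum-syntax; sum-cong-≗; sum-replicate-zero; ∑-distrib-+; *-distribˡ-sum)
  open import Data.Integer.Divisibility.Signed
    using (_∣_; divides; ∣m∣n⇒∣m+n; ∣m⇒∣m*n; ∣n⇒∣m*n; ∣m⇒∣-m; ∣⇒∣ᵤ; ∣ᵤ⇒∣)
  open import Data.Integer.Tactic.RingSolver using (solve-∀)
  open import Data.Nat as ℕ using (ℕ; zero; suc; _∸_; _≤_; _<_; s≤s; z≤n; _!)
  open import Data.Nat.Combinatorics
    using (_C_; nCk+nC[k+1]≡[n+1]C[k+1]; nCk≡nC[n∸k]; nCn≡1; nCk≡n!/k![n-k]!; k![n∸k]!∣n!)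
  import Data.Nat.Divisibility as ℕ
  open import Data.Nat.DivMod using (_/_; m≡m%n+[m/n]*n; m%n<n; m/n*n≡m)
  open import Data.Nat.Primality using (Prime; euclidsLemma; prime⇒nonTrivial; prime⇒nonZero)
  import Data.Nat.Properties as ℕ
  open import Data.Nat.Tactic.RingSolver using () renaming (solve-∀ to ℕ-solve-∀)
  open import Data.Product using (_,_; ∃)
  open import Data.Sum using (inj₁; inj₂)
  open import Relation.Binary.Bundles using (Setoid)
  open import Relation.Binary.PropositionalEquality
  import Relation.Binary.Reasoning.Setoid as SetoidReasoning
  open import Relation.Nullary using (¬_)

  x≡x-mod-p+q*p : ∀ p x → ∃ λ q → x ≡ x mod p ℕ.+ q ℕ.* p
  x≡x-mod-p+q*p zero    x = 0 , sym (ℕ.+-identityʳ x)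
  x≡x-mod-p+q*p (suc p) x = x / suc p , m≡m%n+[m/n]*n x (suc p)

  mod-< : ∀ {p} .{{_ : ℕ.NonZero p}} x → x mod p < p
  mod-< {suc p} x = m%n<n x (suc p)

  F<p : ∀ {p} .{{_ : ℕ.NonZero p}} m i j → F p m i j < p
  F<p m zero    j       = mod-< 1
  F<p m (suc i) zero    = mod-< 1
  F<p m (suc i) (suc j) = mod-< _

  module Congruence (p : ℕ) where

    infix 4 _≈_
    record _≈_ (x y : ℤ) : Set where
      constructor mk≈
      field p∣x-y : + p ∣ x - y

    private
      p∣ : ∀ {x y} → x ≡ y → + p ∣ x → + p ∣ y
      p∣ = subst (+ p ∣_)

    ≈-refl : ∀ {x} → x ≈ x
    ≈-refl {x} = mk≈ (p∣ (sym (ℤ.+-inverseʳ x)) (divides 0ℤ refl))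

    ≡⇒≈ : ∀ {x y} → x ≡ y → x ≈ y
    ≡⇒≈ refl = ≈-refl

    ≈-sym : ∀ {x y} → x ≈ y → y ≈ x
    ≈-sym {x} {y} (mk≈ d) = mk≈ (p∣ (negate x y) (∣m⇒∣-m d))
      where
      negate : ∀ x y → - (x - y) ≡ y - x
      negate = solve-∀

    ≈-trans : ∀ {x y z} → x ≈ y → y ≈ z → x ≈ z
    ≈-trans {x} {y} {z} (mk≈ d) (mk≈ e) = mk≈ (p∣ (telescope x y z) (∣m∣n⇒∣m+n d e))
      where
      telescope : ∀ x y z → (x - y) + (y - z) ≡ x - z
      telescope = solve-∀

    ≈-setoid : Setoid _ _
    ≈-setoid = record
      { Carrier       = ℤ
      ; _≈_           = _≈_
      ; isEquivalence = record { refl = ≈-refl ; sym = ≈-sym ; trans = ≈-trans }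
      }

    +-cong : ∀ {x y u v} → x ≈ y → u ≈ v → x + u ≈ y + v
    +-cong {x} {y} {u} {v} (mk≈ d) (mk≈ e) = mk≈ (p∣ (sym (split x y u v)) (∣m∣n⇒∣m+n d e))
      where
      split : ∀ x y u v → (x + u) - (y + v) ≡ (x - y) + (u - v)
      split = solve-∀

    *-cong : ∀ {x y u v} → x ≈ y → u ≈ v → x * u ≈ y * v
    *-cong {x} {y} {u} {v} (mk≈ d) (mk≈ e) =
      mk≈ (p∣ (sym (split x y u v)) (∣m∣n⇒∣m+n (∣m⇒∣m*n u d) (∣n⇒∣m*n y e)))
      where
      split : ∀ x y u v → x * u - y * v ≡ (x - y) * u + y * (u - v)
      split = solve-∀

    *-congˡ : ∀ a {u v} → u ≈ v → a * u ≈ a * v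
    *-congˡ a = *-cong (≈-refl {a})

    -‿cong : ∀ {x y} → x ≈ y → - x ≈ - y
    -‿cong {x} {y} (mk≈ d) = mk≈ (p∣ (sym (split x y)) (∣m⇒∣-m d))
      where
      split : ∀ x y → - x - - y ≡ - (x - y)
      split = solve-∀

    ∑-cong : ∀ {N} {f g : Fin N → ℤ} → (∀ k → f k ≈ g k) → (∑[ k < N ] f k) ≈ (∑[ k < N ] g k)
    ∑-cong {zero}  f≈g = ≈-refl
    ∑-cong {suc N} f≈g = +-cong (f≈g Fin.zero) (∑-cong (λ k → f≈g (Fin.suc k)))

    ≈0⇒∣ : ∀ {x} → x ≈ 0ℤ → p ℕ.∣ ∣ x ∣
    ≈0⇒∣ {x} (mk≈ d) = ∣⇒∣ᵤ (p∣ (ℤ.+-identityʳ x) d)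

    ∣⇒≈0 : ∀ {x} → p ℕ.∣ ∣ x ∣ → x ≈ 0ℤ
    ∣⇒≈0 {x} d = mk≈ (p∣ (sym (ℤ.+-identityʳ x)) (∣ᵤ⇒∣ d))

    <p∧≈0⇒≡0 : ∀ {n} → n < p → + n ≈ 0ℤ → n ≡ 0
    <p∧≈0⇒≡0 {zero}  _   _      = refl
    <p∧≈0⇒≡0 {suc n} n<p 1+n≈0 = ⊥-elim (ℕ.<⇒≱ n<p (ℕ.∣⇒≤ (≈0⇒∣ 1+n≈0)))

    mod-≈ : ∀ x → + (x mod p) ≈ + x
    mod-≈ x with x≡x-mod-p+q*p p x
    ... | q , x≡r+q*p = ≈-sym (begin
      + x                        ≡⟨ cong +_ x≡r+q*p ⟩
      + (x mod p ℕ.+ q ℕ.* p)    ≡⟨ ℤ.pos-+ (x mod p) (q ℕ.* p) ⟩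
      + (x mod p) + + (q ℕ.* p)  ≈⟨ +-cong (≈-refl {+ (x mod p)}) (∣⇒≈0 {+ (q ℕ.* p)} (ℕ.n∣m*n q)) ⟩
      + (x mod p) + 0ℤ           ≡⟨ ℤ.+-identityʳ (+ (x mod p)) ⟩
      + (x mod p)                ∎)
      where open SetoidReasoning ≈-setoid

    mod≡0⇒≈0 : ∀ x → x mod p ≡ 0 → + x ≈ 0ℤ
    mod≡0⇒≈0 x x≡0 = ≈-trans (≈-sym (mod-≈ x)) (≡⇒≈ (cong +_ x≡0))

  n∣n! : ∀ n → .{{ℕ.NonZero n}} → n ℕ.∣ n !
  n∣n! (suc n) = ℕ.m∣m*n (n !)

  nCk*k!*[n∸k]!≡n! : ∀ {n k} → k ≤ n → (n C k) ℕ.* (k ! ℕ.* (n ∸ k) !) ≡ n !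
  nCk*k!*[n∸k]!≡n! {n} {k} k≤n =
    trans (cong (ℕ._* (k ! ℕ.* (n ∸ k) !)) (nCk≡n!/k![n-k]! k≤n)) (m/n*n≡m (k![n∸k]!∣n! k≤n))
    where instance _ = k ℕ.!* (n ∸ k) !≢0

  pascal-ℤ : ∀ n k → + (n C k) + + (n C suc k) ≡ + (suc n C suc k)
  pascal-ℤ n k = trans (sym (ℤ.pos-+ (n C k) (n C suc k))) (cong +_ (nCk+nC[k+1]≡[n+1]C[k+1] n k))

  pascal-difference : ∀ n r → + (n C suc r) ≡ + (suc n C suc r) - + (n C r)
  pascal-difference n r = trans (move (+ (n C suc r)) (+ (n C r))) (cong (_- + (n C r)) (pascal-ℤ n r))
    where
    move : ∀ x y → x ≡ y + x - y
    move = solve-∀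

  alternating-pascal : ∀ n r →
    -1ℤ ^ suc r * + (n C suc r) - -1ℤ ^ r * + (n C r) ≡ -1ℤ ^ suc r * + (suc n C suc r)
  alternating-pascal n r =
    trans (factor (-1ℤ ^ r) (+ (n C suc r)) (+ (n C r))) (cong (-1ℤ ^ suc r *_) (pascal-ℤ n r))
    where
    factor : ∀ s x y → (-1ℤ * s) * x - s * y ≡ (-1ℤ * s) * (y + x)
    factor = solve-∀

  module _ {p : ℕ} (prime : Prime p) where

    open Congruence p
    open SetoidReasoning ≈-setoid

    prime∤n! : ∀ {n} → n < p → ¬ p ℕ.∣ n !
    prime∤n! {zero}  _   p∣1  =
      ℕ.<⇒≢ (ℕ.nonTrivial⇒n>1 p {{prime⇒nonTrivial prime}}) (sym (ℕ.∣1⇒≡1 p∣1))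
    prime∤n! {suc n} n<p p∣n! with euclidsLemma (suc n) (n !) prime p∣n!
    ... | inj₁ p∣1+n = ℕ.<⇒≱ n<p (ℕ.∣⇒≤ p∣1+n)
    ... | inj₂ p∣n!′ = prime∤n! (ℕ.<-trans (ℕ.n<1+n n) n<p) p∣n!′

    prime∤nCk : ∀ {n k} → n < p → k ≤ n → ¬ p ℕ.∣ n C k
    prime∤nCk {n} {k} n<p k≤n p∣nCk =
      prime∤n! n<p (subst (p ℕ.∣_) (nCk*k!*[n∸k]!≡n! k≤n) (ℕ.∣-trans p∣nCk (ℕ.m∣m*n _)))

    prime∣pCk : ∀ {k} → 0 < k → k < p → p ℕ.∣ p C k
    prime∣pCk {k} 0<k k<p
      with euclidsLemma (p C k) (k ! ℕ.* (p ∸ k) !) prime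
             (subst (p ℕ.∣_) (sym (nCk*k!*[n∸k]!≡n! (ℕ.<⇒≤ k<p))) (n∣n! p {{prime⇒nonZero prime}}))
    ... | inj₁ p∣pCk = p∣pCk
    ... | inj₂ p∣k![p∸k]! with euclidsLemma (k !) ((p ∸ k) !) prime p∣k![p∸k]!
    ...   | inj₁ p∣k!     = ⊥-elim (prime∤n! k<p p∣k!)
    ...   | inj₂ p∣[p∸k]! = ⊥-elim (prime∤n! (ℕ.∸-monoʳ-< 0<k (ℕ.<⇒≤ k<p)) p∣[p∸k]!)

    [p∸1]Cr≈[-1]^r : ∀ {n r} → suc n ≡ p → r ≤ n → + (n C r) ≈ -1ℤ ^ r
    [p∸1]Cr≈[-1]^r {n} {zero}  _     _   = ≈-refl
    [p∸1]Cr≈[-1]^r {n} {suc r} 1+n≡p r<n = begin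
      + (n C suc r)                  ≡⟨ pascal-difference n r ⟩
      + (suc n C suc r) - + (n C r)  ≈⟨ +-cong p∣[1+n]C[1+r] (-‿cong (IH (ℕ.<⇒≤ r<n))) ⟩
      0ℤ - -1ℤ ^ r                   ≡⟨ ℤ.+-identityˡ (- (-1ℤ ^ r)) ⟩
      - (-1ℤ ^ r)                    ≡⟨ ℤ.-1*i≡-i (-1ℤ ^ r) ⟨
      -1ℤ ^ suc r                    ∎
      where
      IH = [p∸1]Cr≈[-1]^r 1+n≡p
      p∣[1+n]C[1+r] : + (suc n C suc r) ≈ 0ℤ
      p∣[1+n]C[1+r] = ∣⇒≈0 (subst (λ m → p ℕ.∣ m C suc r) (sym 1+n≡p)
                        (prime∣pCk (s≤s z≤n) (subst (suc r <_) 1+n≡p (s≤s r<n))))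

    -- The mod-p shadow of negating the upper index, C(-1-a, r) = (-1)ʳ C(a+r, r).
    upper-negation : ∀ a {n r} → n ℕ.+ suc a ≡ p → r ≤ n → + (n C r) ≈ -1ℤ ^ r * + ((a ℕ.+ r) C r)
    upper-negation zero {n} {r} n+1≡p r≤n = begin
      + (n C r)            ≈⟨ [p∸1]Cr≈[-1]^r (trans (ℕ.+-comm 1 n) n+1≡p) r≤n ⟩
      -1ℤ ^ r              ≡⟨ ℤ.*-identityʳ (-1ℤ ^ r) ⟨
      -1ℤ ^ r * + 1        ≡⟨ cong (λ m → -1ℤ ^ r * + m) (nCn≡1 r) ⟨
      -1ℤ ^ r * + (r C r)  ∎
    upper-negation (suc a) {n} {zero}  _ _ = ≈-refl
    upper-negation (suc a) {n} {suc r} n+2+a≡p r<n = begin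
      + (n C suc r)
        ≡⟨ pascal-difference n r ⟩
      + (suc n C suc r) - + (n C r)
        ≈⟨ +-cong (upper-negation a (trans (sym (ℕ.+-suc n (suc a))) n+2+a≡p) (ℕ.m≤n⇒m≤1+n r<n))
                  (-‿cong (upper-negation (suc a) n+2+a≡p (ℕ.<⇒≤ r<n))) ⟩
      -1ℤ ^ suc r * + (m C suc r) - -1ℤ ^ r * + ((suc a ℕ.+ r) C r)
        ≡⟨ cong (λ k → -1ℤ ^ suc r * + (m C suc r) - -1ℤ ^ r * + (k C r)) (ℕ.+-suc a r) ⟨
      -1ℤ ^ suc r * + (m C suc r) - -1ℤ ^ r * + (m C r)
        ≡⟨ alternating-pascal m r ⟩
      -1ℤ ^ suc r * + (suc m C suc r)
        ∎
      where
      m = a ℕ.+ suc r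

    ^-*-cancelˡ-≈0 : ∀ {a} → ¬ p ℕ.∣ ∣ a ∣ → ∀ i {x} → a ^ i * x ≈ 0ℤ → x ≈ 0ℤ
    ^-*-cancelˡ-≈0 p∤a zero {x} 1x≈0 = ≈-trans (≡⇒≈ (sym (ℤ.*-identityˡ x))) 1x≈0
    ^-*-cancelˡ-≈0 {a} p∤a (suc i) {x} aaⁱx≈0 =
      ^-*-cancelˡ-≈0 p∤a i (cancel (≈-trans (≡⇒≈ (sym (ℤ.*-assoc a (a ^ i) x))) aaⁱx≈0))
      where
      cancel : ∀ {y} → a * y ≈ 0ℤ → y ≈ 0ℤ
      cancel {y} ay≈0
        with euclidsLemma ∣ a ∣ ∣ y ∣ prime (subst (p ℕ.∣_) (ℤ.abs-* a y) (≈0⇒∣ ay≈0))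
      ... | inj₁ p∣a = ⊥-elim (p∤a p∣a)
      ... | inj₂ p∣y = ∣⇒≈0 p∣y

  Series : Set
  Series = ℕ → ℤ

  Operator : Set
  Operator = Series → Series

  𝟏 : Series
  𝟏 zero    = 1ℤ
  𝟏 (suc _) = 0ℤ

  infix 8 _·t
  _·t : ℤ → Operator
  (a ·t) Y zero    = 0ℤ
  (a ·t) Y (suc r) = a * Y r

  infix 7 𝟙+_
  𝟙+_ : Operator → Operator
  (𝟙+ U) Y r = Y r + U Y r

  infixl 9 _^[_]
  _^[_] : Operator → ℕ → Operator
  (U ^[ zero ])  Y = Y
  (U ^[ suc n ]) Y = U ((U ^[ n ]) Y)

  Congruent : Operator → Set
  Congruent U = ∀ {Y Z} → Y ≗ Z → U Y ≗ U Z

  record IsLinear (U : Operator) : Set where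
    field
      cong-≗ : Congruent U
      ∑-homo : ∀ {N} (c : Fin N → ℤ) (f : Fin N → Series) →
               U (λ s → ∑[ k < N ] (c k * f k s)) ≗ λ s → ∑[ k < N ] (c k * U (f k) s)

  ∑-zero : ∀ {N} (f : Fin N → ℤ) → (∀ k → f k ≡ 0ℤ) → ∑[ k < N ] f k ≡ 0ℤ
  ∑-zero {N} f f≗0 = trans (sum-cong-≗ f≗0) (sum-replicate-zero N)

  ·t-linear : ∀ a → IsLinear (a ·t)
  ·t-linear a = record { cong-≗ = cong-≗ ; ∑-homo = ∑-homo }
    where
    cong-≗ : Congruent (a ·t)
    cong-≗ Y≗Z zero    = refl
    cong-≗ Y≗Z (suc r) = cong (a *_) (Y≗Z r)
    ∑-homo : ∀ {N} (c : Fin N → ℤ) (f : Fin N → Series) →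
             (a ·t) (λ s → ∑[ k < N ] (c k * f k s)) ≗ λ s → ∑[ k < N ] (c k * (a ·t) (f k) s)
    ∑-homo {N} c f zero    = sym (∑-zero {N} _ (λ k → ℤ.*-zeroʳ (c k)))
    ∑-homo {N} c f (suc r) =
      trans (*-distribˡ-sum a (λ k → c k * f k r)) (sum-cong-≗ (λ k → swap a (c k) (f k r)))
      where
      swap : ∀ a c x → a * (c * x) ≡ c * (a * x)
      swap = solve-∀

  𝟙+-linear : ∀ {U} → IsLinear U → IsLinear (𝟙+ U)
  𝟙+-linear {U} lin = record { cong-≗ = cong-≗ ; ∑-homo = ∑-homo }
    where
    module U = IsLinear lin
    cong-≗ : Congruent (𝟙+ U)
    cong-≗ Y≗Z r = cong₂ _+_ (Y≗Z r) (U.cong-≗ Y≗Z r)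
    ∑-homo : ∀ {N} (c : Fin N → ℤ) (f : Fin N → Series) →
             (𝟙+ U) (λ s → ∑[ k < N ] (c k * f k s)) ≗ λ s → ∑[ k < N ] (c k * (𝟙+ U) (f k) s)
    ∑-homo {N} c f r = begin
      (∑[ k < N ] (c k * f k r)) + U (λ s → ∑[ k < N ] (c k * f k s)) r
        ≡⟨ cong (λ t → (∑[ k < N ] (c k * f k r)) + t) (U.∑-homo c f r) ⟩
      (∑[ k < N ] (c k * f k r)) + (∑[ k < N ] (c k * U (f k) r))
        ≡⟨ ∑-distrib-+ (λ k → c k * f k r) (λ k → c k * U (f k) r) ⟨
      ∑[ k < N ] (c k * f k r + c k * U (f k) r)
        ≡⟨ sum-cong-≗ (λ k → ℤ.*-distribˡ-+ (c k) (f k r) (U (f k) r)) ⟨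
      ∑[ k < N ] (c k * (f k r + U (f k) r))
        ∎
      where open ≡-Reasoning

  ^-comm : (U V : Operator) → Congruent U → (∀ Y → U (V Y) ≗ V (U Y)) →
           ∀ n Y → (U ^[ n ]) (V Y) ≗ V ((U ^[ n ]) Y)
  ^-comm U V U-cong UV≗VU zero    Y r = refl
  ^-comm U V U-cong UV≗VU (suc n) Y r = trans (U-cong (^-comm U V U-cong UV≗VU n Y) r) (UV≗VU _ r)

  ^-+ : ∀ U m n Y → (U ^[ m ]) ((U ^[ n ]) Y) ≡ (U ^[ m ℕ.+ n ]) Y
  ^-+ U zero    n Y = refl
  ^-+ U (suc m) n Y = cong U (^-+ U m n Y)

  pascal-∑ : ∀ i M (w : ℕ → ℤ) →
    (∑[ k < suc M ] (+ (i C toℕ k) * w (toℕ k))) + (∑[ k < M ] (+ (i C toℕ k) * w (suc (toℕ k))))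
      ≡ ∑[ k < suc M ] (+ (suc i C toℕ k) * w (toℕ k))
  pascal-∑ i M w = begin
    (1ℤ * w 0 + S) + T
      ≡⟨ reassoc (1ℤ * w 0) S T ⟩
    1ℤ * w 0 + (T + S)
      ≡⟨ cong (λ t → 1ℤ * w 0 + t)
              (∑-distrib-+ (λ k → + (i C toℕ k) * w′ k) (λ k → + (i C suc (toℕ k)) * w′ k)) ⟨
    1ℤ * w 0 + ∑[ k < M ] (+ (i C toℕ k) * w′ k + + (i C suc (toℕ k)) * w′ k)
      ≡⟨ cong (λ t → 1ℤ * w 0 + t) (sum-cong-≗ λ k →
           trans (sym (ℤ.*-distribʳ-+ (w′ k) (+ (i C toℕ k)) (+ (i C suc (toℕ k)))))
                 (cong (_* w′ k) (pascal-ℤ i (toℕ k)))) ⟩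
    1ℤ * w 0 + ∑[ k < M ] (+ (suc i C suc (toℕ k)) * w′ k)
      ∎
    where
    open ≡-Reasoning
    w′ : Fin M → ℤ
    w′ k = w (suc (toℕ k))
    S = ∑[ k < M ] (+ (i C suc (toℕ k)) * w′ k)
    T = ∑[ k < M ] (+ (i C toℕ k) * w′ k)
    reassoc : ∀ x s t → (x + s) + t ≡ x + (t + s)
    reassoc = solve-∀

  -- The bound N is arbitrary (beyond i): the inductive step uses the hypothesis at two bounds.
  binomial-theorem : ∀ {U} → IsLinear U → ∀ i {N} → i < N → ∀ Y →
    ((𝟙+ U) ^[ i ]) Y ≗ λ r → ∑[ k < N ] (+ (i C toℕ k) * (U ^[ toℕ k ]) Y r)
  binomial-theorem {U} lin zero {suc M} _ Y r = begin
    Y r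
      ≡⟨ ℤ.*-identityˡ (Y r) ⟨
    1ℤ * Y r
      ≡⟨ ℤ.+-identityʳ (1ℤ * Y r) ⟨
    1ℤ * Y r + 0ℤ
      ≡⟨ cong (λ t → 1ℤ * Y r + t) (∑-zero {M} _ (λ k → ℤ.*-zeroˡ ((U ^[ suc (toℕ k) ]) Y r))) ⟨
    1ℤ * Y r + (∑[ k < M ] (+ (0 C suc (toℕ k)) * (U ^[ suc (toℕ k) ]) Y r))
      ∎
    where open ≡-Reasoning
  binomial-theorem {U} lin (suc i) {suc M} (s≤s i<M) Y r = begin
    (𝟙+ U) Z r
      ≡⟨ cong₂ _+_ (binomial-theorem lin i (ℕ.m<n⇒m<1+n i<M) Y r)
                   (trans (U.cong-≗ (binomial-theorem lin i i<M Y) r)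
                          (U.∑-homo {M} (λ k → + (i C toℕ k)) (λ k → (U ^[ toℕ k ]) Y) r)) ⟩
    (∑[ k < suc M ] (+ (i C toℕ k) * W (toℕ k))) + (∑[ k < M ] (+ (i C toℕ k) * W (suc (toℕ k))))
      ≡⟨ pascal-∑ i M W ⟩
    ∑[ k < suc M ] (+ (suc i C toℕ k) * W (toℕ k))
      ∎
    where
    open ≡-Reasoning
    module U = IsLinear lin
    Z = ((𝟙+ U) ^[ i ]) Y
    W : ℕ → ℤ
    W k = (U ^[ k ]) Y r

  binomial-series : ∀ n r → ((𝟙+ (1ℤ ·t)) ^[ n ]) 𝟏 r ≡ + (n C r)
  binomial-series zero    zero    = refl
  binomial-series zero    (suc r) = refl
  binomial-series (suc n) zero    = trans (ℤ.+-identityʳ _) (binomial-series n zero)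
  binomial-series (suc n) (suc r) = begin
    X (suc r) + 1ℤ * X r
      ≡⟨ cong₂ (λ u v → u + 1ℤ * v) (binomial-series n (suc r)) (binomial-series n r) ⟩
    + (n C suc r) + 1ℤ * + (n C r)
      ≡⟨ cong (λ x → + (n C suc r) + x) (ℤ.*-identityˡ (+ (n C r))) ⟩
    + (n C suc r) + + (n C r)
      ≡⟨ ℤ.+-comm (+ (n C suc r)) (+ (n C r)) ⟩
    + (n C r) + + (n C suc r)
      ≡⟨ pascal-ℤ n r ⟩
    + (suc n C suc r)
      ∎
    where
    open ≡-Reasoning
    X = ((𝟙+ (1ℤ ·t)) ^[ n ]) 𝟏

  ·t-^ : ∀ a k {r} Y → k ≤ r → ((a ·t) ^[ k ]) Y r ≡ a ^ k * Y (r ∸ k)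
  ·t-^ a zero    Y _ = sym (ℤ.*-identityˡ _)
  ·t-^ a (suc k) {suc r} Y (s≤s k≤r) =
    trans (cong (a *_) (·t-^ a k Y k≤r)) (sym (ℤ.*-assoc a (a ^ k) (Y (r ∸ k))))

  ·t-scale : ∀ c Y r → (c ·t) Y r ≡ c * (1ℤ ·t) Y r
  ·t-scale c Y zero    = sym (ℤ.*-zeroʳ c)
  ·t-scale c Y (suc r) = cong (c *_) (sym (ℤ.*-identityˡ (Y r)))

  𝟙+·t-^-at-0 : ∀ a n Y → ((𝟙+ (a ·t)) ^[ n ]) Y 0 ≡ Y 0
  𝟙+·t-^-at-0 a zero    Y = refl
  𝟙+·t-^-at-0 a (suc n) Y = trans (ℤ.+-identityʳ _) (𝟙+·t-^-at-0 a n Y)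

  𝟙+·t-congruent : ∀ a → Congruent (𝟙+ (a ·t))
  𝟙+·t-congruent a = IsLinear.cong-≗ (𝟙+-linear (·t-linear a))

  𝟙+·t-comm : ∀ a b Y → (𝟙+ (a ·t)) ((𝟙+ (b ·t)) Y) ≗ (𝟙+ (b ·t)) ((𝟙+ (a ·t)) Y)
  𝟙+·t-comm a b Y zero          = refl
  𝟙+·t-comm a b Y (suc zero)    = swap (Y 1) (Y 0) a b
    where
    swap : ∀ y₁ y₀ a b → (y₁ + b * y₀) + a * (y₀ + 0ℤ) ≡ (y₁ + a * y₀) + b * (y₀ + 0ℤ)
    swap = solve-∀
  𝟙+·t-comm a b Y (suc (suc r)) = swap (Y (suc (suc r))) (Y (suc r)) (Y r) a b
    where
    swap : ∀ y₂ y₁ y₀ a b →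
      (y₂ + b * y₁) + a * (y₁ + b * y₀) ≡ (y₂ + a * y₁) + b * (y₁ + a * y₀)
    swap = solve-∀

  𝟙+·t-^-comm : ∀ a b n Y →
    ((𝟙+ (a ·t)) ^[ n ]) ((𝟙+ (b ·t)) Y) ≗ (𝟙+ (b ·t)) (((𝟙+ (a ·t)) ^[ n ]) Y)
  𝟙+·t-^-comm a b = ^-comm (𝟙+ (a ·t)) (𝟙+ (b ·t)) (𝟙+·t-congruent a) (𝟙+·t-comm a b)

  entry : ℤ → ℕ → ℕ → ℤ
  entry c i j = ((𝟙+ (c ·t)) ^[ i ]) (((𝟙+ (1ℤ ·t)) ^[ j ]) 𝟏) j

  entry-zero-row : ∀ c j → entry c 0 j ≡ 1ℤ
  entry-zero-row c j = trans (binomial-series j j) (cong +_ (nCn≡1 j))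

  entry-zero-column : ∀ c i → entry c i 0 ≡ 1ℤ
  entry-zero-column c i = 𝟙+·t-^-at-0 c i 𝟏

  entry-recurrence : ∀ c i j →
    entry c i (suc j) + (c - 1ℤ) * entry c i j + entry c (suc i) j ≡ entry c (suc i) (suc j)
  entry-recurrence c i j = begin
    entry c i (suc j) + (c - 1ℤ) * Q j + (Q j + (c ·t) Q j)
      ≡⟨ cong₂ (λ u v → u + (c - 1ℤ) * Q j + (Q j + v))
               (𝟙+·t-^-comm c 1ℤ i B (suc j)) (·t-scale c Q j) ⟩
    (Q (suc j) + 1ℤ * Q j) + (c - 1ℤ) * Q j + (Q j + c * (1ℤ ·t) Q j)
      ≡⟨ collect (Q (suc j)) (Q j) ((1ℤ ·t) Q j) c ⟩
    (Q (suc j) + 1ℤ * Q j) + c * (Q j + (1ℤ ·t) Q j)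
      ≡⟨ 𝟙+·t-congruent c (𝟙+·t-^-comm c 1ℤ i B) (suc j) ⟨
    entry c (suc i) (suc j)
      ∎
    where
    open ≡-Reasoning
    B = ((𝟙+ (1ℤ ·t)) ^[ j ]) 𝟏
    Q = ((𝟙+ (c ·t)) ^[ i ]) B
    collect : ∀ q₁ q₀ s c →
      (q₁ + 1ℤ * q₀) + (c - 1ℤ) * q₀ + (q₀ + c * s) ≡ (q₁ + 1ℤ * q₀) + c * (q₀ + s)
    collect = solve-∀

  [1-t²]^_ : ℕ → Series
  [1-t²]^ i = ((𝟙+ (-1ℤ ·t)) ^[ i ]) (((𝟙+ (1ℤ ·t)) ^[ i ]) 𝟏)

  [1-t²]^-suc : ∀ i → [1-t²]^ (suc i) ≗ (𝟙+ (-1ℤ ·t)) ((𝟙+ (1ℤ ·t)) ([1-t²]^ i))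
  [1-t²]^-suc i = 𝟙+·t-congruent -1ℤ (𝟙+·t-^-comm -1ℤ 1ℤ i _)

  [1-t²]·-at-1 : ∀ Y → (𝟙+ (-1ℤ ·t)) ((𝟙+ (1ℤ ·t)) Y) 1 ≡ Y 1
  [1-t²]·-at-1 Y = cancel (Y 1) (Y 0)
    where
    cancel : ∀ y₁ y₀ → (y₁ + 1ℤ * y₀) + -1ℤ * (y₀ + 0ℤ) ≡ y₁
    cancel = solve-∀

  [1-t²]·-at-2+ : ∀ Y r → (𝟙+ (-1ℤ ·t)) ((𝟙+ (1ℤ ·t)) Y) (suc (suc r)) ≡ Y (suc (suc r)) - Y r
  [1-t²]·-at-2+ Y r = cancel (Y (suc (suc r))) (Y (suc r)) (Y r)
    where
    cancel : ∀ y₂ y₁ y₀ → (y₂ + 1ℤ * y₁) + -1ℤ * (y₁ + 1ℤ * y₀) ≡ y₂ - y₀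
    cancel = solve-∀

  [1-t²]^-odd : ∀ i k → ([1-t²]^ i) (suc (k ℕ.* 2)) ≡ 0ℤ
  [1-t²]^-odd zero    k       = refl
  [1-t²]^-odd (suc i) zero    =
    trans ([1-t²]^-suc i 1) (trans ([1-t²]·-at-1 ([1-t²]^ i)) ([1-t²]^-odd i zero))
  [1-t²]^-odd (suc i) (suc k) = begin
    ([1-t²]^ suc i) (suc (suc k ℕ.* 2))
      ≡⟨ [1-t²]^-suc i _ ⟩
    (𝟙+ (-1ℤ ·t)) ((𝟙+ (1ℤ ·t)) ([1-t²]^ i)) (suc (suc k ℕ.* 2))
      ≡⟨ [1-t²]·-at-2+ ([1-t²]^ i) (suc (k ℕ.* 2)) ⟩
    ([1-t²]^ i) (suc (suc k ℕ.* 2)) - ([1-t²]^ i) (suc (k ℕ.* 2))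
      ≡⟨ cong₂ _-_ ([1-t²]^-odd i (suc k)) ([1-t²]^-odd i k) ⟩
    0ℤ
      ∎
    where open ≡-Reasoning

  [1-t²]^-even : ∀ i k → ([1-t²]^ i) (k ℕ.* 2) ≡ -1ℤ ^ k * + (i C k)
  [1-t²]^-even i       zero    = trans (𝟙+·t-^-at-0 -1ℤ i _) (𝟙+·t-^-at-0 1ℤ i 𝟏)
  [1-t²]^-even zero    (suc k) = sym (ℤ.*-zeroʳ (-1ℤ ^ suc k))
  [1-t²]^-even (suc i) (suc k) = begin
    ([1-t²]^ suc i) (suc k ℕ.* 2)
      ≡⟨ [1-t²]^-suc i _ ⟩
    (𝟙+ (-1ℤ ·t)) ((𝟙+ (1ℤ ·t)) ([1-t²]^ i)) (suc k ℕ.* 2)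
      ≡⟨ [1-t²]·-at-2+ ([1-t²]^ i) (k ℕ.* 2) ⟩
    ([1-t²]^ i) (suc k ℕ.* 2) - ([1-t²]^ i) (k ℕ.* 2)
      ≡⟨ cong₂ _-_ ([1-t²]^-even i (suc k)) ([1-t²]^-even i k) ⟩
    -1ℤ ^ suc k * + (i C suc k) - -1ℤ ^ k * + (i C k)
      ≡⟨ alternating-pascal i k ⟩
    -1ℤ ^ suc k * + (suc i C suc k)
      ∎
    where open ≡-Reasoning

  odd⇒≡1+k*2 : ∀ {i} → i mod 2 ≡ 1 → i ≡ suc (i / 2 ℕ.* 2)
  odd⇒≡1+k*2 {i} i%2≡1 = trans (m≡m%n+[m/n]*n i 2) (cong (ℕ._+ i / 2 ℕ.* 2) i%2≡1)

  even⇒≡k*2 : ∀ {i} → i mod 2 ≡ 0 → i ≡ i / 2 ℕ.* 2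
  even⇒≡k*2 {i} i%2≡0 = trans (m≡m%n+[m/n]*n i 2) (cong (ℕ._+ i / 2 ℕ.* 2) i%2≡0)

  [1-t²]^-odd-diagonal : ∀ i → i mod 2 ≡ 1 → ([1-t²]^ i) i ≡ 0ℤ
  [1-t²]^-odd-diagonal i odd =
    subst (λ r → ([1-t²]^ i) r ≡ 0ℤ) (sym (odd⇒≡1+k*2 odd)) ([1-t²]^-odd i (i / 2))

  module _ (p : ℕ) where

    open Congruence p
    open SetoidReasoning ≈-setoid

    F≈entry : ∀ m c → + m ≈ c - 1ℤ → ∀ i j → + F p m i j ≈ entry c i j
    F≈entry m c m≈c-1 zero    j       = ≈-trans (mod-≈ 1) (≡⇒≈ (sym (entry-zero-row c j)))
    F≈entry m c m≈c-1 (suc i) zero    = ≈-trans (mod-≈ 1) (≡⇒≈ (sym (entry-zero-column c (suc i))))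
    F≈entry m c m≈c-1 (suc i) (suc j) = begin
      + F p m (suc i) (suc j)
        ≈⟨ mod-≈ (a ℕ.+ m ℕ.* b ℕ.+ d) ⟩
      + (a ℕ.+ m ℕ.* b ℕ.+ d)
        ≡⟨ ℤ.pos-+ (a ℕ.+ m ℕ.* b) d ⟩
      + (a ℕ.+ m ℕ.* b) + + d
        ≡⟨ cong (_+ + d) (trans (ℤ.pos-+ a (m ℕ.* b)) (cong (λ x → + a + x) (ℤ.pos-* m b))) ⟩
      + a + + m * + b + + d
        ≈⟨ +-cong (+-cong (F≈entry m c m≈c-1 i (suc j)) (*-cong m≈c-1 (F≈entry m c m≈c-1 i j)))
                  (F≈entry m c m≈c-1 (suc i) j) ⟩
      entry c i (suc j) + (c - 1ℤ) * entry c i j + entry c (suc i) j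
        ≡⟨ entry-recurrence c i j ⟩
      entry c (suc i) (suc j)
        ∎
      where
      a = F p m i (suc j)
      b = F p m i j
      d = F p m (suc i) j

    2ⁱ[1+ct]ⁱ≈[2+t]ⁱ : ∀ {c} → (+ 2) * c ≈ 1ℤ → ∀ i Y r →
      (+ 2) ^ i * ((𝟙+ (c ·t)) ^[ i ]) Y r ≈ ((𝟙+ (𝟙+ (1ℤ ·t))) ^[ i ]) Y r
    2ⁱ[1+ct]ⁱ≈[2+t]ⁱ 2c≈1 zero Y r = ≡⇒≈ (ℤ.*-identityˡ (Y r))
    2ⁱ[1+ct]ⁱ≈[2+t]ⁱ {c} 2c≈1 (suc i) Y = step
      where
      q = (+ 2) ^ i
      Z = ((𝟙+ (c ·t)) ^[ i ]) Y
      V = ((𝟙+ (𝟙+ (1ℤ ·t))) ^[ i ]) Y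
      IH = 2ⁱ[1+ct]ⁱ≈[2+t]ⁱ 2c≈1 i Y
      step : ∀ r → (+ 2 * q) * (𝟙+ (c ·t)) Z r ≈ (𝟙+ (𝟙+ (1ℤ ·t))) V r
      step zero = begin
        (+ 2 * q) * (Z 0 + 0ℤ)    ≡⟨ double q (Z 0) ⟩
        q * Z 0 + (q * Z 0 + 0ℤ)  ≈⟨ +-cong (IH 0) (+-cong (IH 0) ≈-refl) ⟩
        V 0 + (V 0 + 0ℤ)          ∎
        where
        double : ∀ q z → (+ 2 * q) * (z + 0ℤ) ≡ q * z + (q * z + 0ℤ)
        double = solve-∀
      step (suc r) = begin
        (+ 2 * q) * (Z (suc r) + c * Z r)
          ≡⟨ double q (Z (suc r)) (Z r) c ⟩
        q * Z (suc r) + (q * Z (suc r) + (+ 2 * c) * (q * Z r))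
          ≈⟨ +-cong (IH (suc r)) (+-cong (IH (suc r)) (*-cong 2c≈1 (IH r))) ⟩
        V (suc r) + (V (suc r) + 1ℤ * V r)
          ∎
        where
        double : ∀ q z₁ z₀ c → (+ 2 * q) * (z₁ + c * z₀) ≡ q * z₁ + (q * z₁ + (+ 2 * c) * (q * z₀))
        double = solve-∀

  module _ {p : ℕ} (prime : Prime p) where

    open Congruence p
    open SetoidReasoning ≈-setoid

    2ⁱ·entry≈[1-t²]ⁱ : ∀ {c} → (+ 2) * c ≈ 1ℤ → ∀ i j → suc (i ℕ.+ j) ≡ p →
      (+ 2) ^ i * entry c i j ≈ ([1-t²]^ i) i
    2ⁱ·entry≈[1-t²]ⁱ {c} 2c≈1 i j 1+i+j≡p = begin
      (+ 2) ^ i * entry c i j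
        ≈⟨ 2ⁱ[1+ct]ⁱ≈[2+t]ⁱ p 2c≈1 i B j ⟩
      ((𝟙+ (𝟙+ (1ℤ ·t))) ^[ i ]) B j
        ≡⟨ binomial-theorem (𝟙+-linear (·t-linear 1ℤ)) i ℕ.≤-refl B j ⟩
      ∑[ k < suc i ] (+ (i C toℕ k) * ((𝟙+ (1ℤ ·t)) ^[ toℕ k ]) B j)
        ≈⟨ ∑-cong (λ k → *-congˡ (+ (i C toℕ k)) (term (toℕ k) (ℕ.s≤s⁻¹ (toℕ<n k)))) ⟩
      ∑[ k < suc i ] (+ (i C toℕ k) * ((-1ℤ ·t) ^[ toℕ k ]) A i)
        ≡⟨ binomial-theorem (·t-linear -1ℤ) i ℕ.≤-refl A i ⟨
      ([1-t²]^ i) i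
        ∎
      where
      A = ((𝟙+ (1ℤ ·t)) ^[ i ]) 𝟏
      B = ((𝟙+ (1ℤ ·t)) ^[ j ]) 𝟏
      term : ∀ k → k ≤ i → ((𝟙+ (1ℤ ·t)) ^[ k ]) B j ≈ ((-1ℤ ·t) ^[ k ]) A i
      term k k≤i = begin
        ((𝟙+ (1ℤ ·t)) ^[ k ]) B j        ≡⟨ cong (λ Y → Y j) (^-+ (𝟙+ (1ℤ ·t)) k j 𝟏) ⟩
        ((𝟙+ (1ℤ ·t)) ^[ k ℕ.+ j ]) 𝟏 j  ≡⟨ binomial-series (k ℕ.+ j) j ⟩
        + ((k ℕ.+ j) C j)                ≡⟨ cong +_ symmetry ⟩
        + ((k ℕ.+ j) C k)                ≈⟨ upper-negation prime (i ∸ k) k+j+1+[i∸k]≡p (ℕ.m≤m+n k j) ⟩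
        -1ℤ ^ k * + ((i ∸ k ℕ.+ k) C k)  ≡⟨ cong (λ n → -1ℤ ^ k * + (n C k)) (ℕ.m∸n+n≡m k≤i) ⟩
        -1ℤ ^ k * + (i C k)              ≡⟨ cong (λ n → -1ℤ ^ k * + n) (nCk≡nC[n∸k] k≤i) ⟩
        -1ℤ ^ k * + (i C (i ∸ k))        ≡⟨ cong (-1ℤ ^ k *_) (binomial-series i (i ∸ k)) ⟨
        -1ℤ ^ k * A (i ∸ k)              ≡⟨ ·t-^ -1ℤ k A k≤i ⟨
        ((-1ℤ ·t) ^[ k ]) A i            ∎
        where
        symmetry : (k ℕ.+ j) C j ≡ (k ℕ.+ j) C k
        symmetry = sym (trans (nCk≡nC[n∸k] (ℕ.m≤m+n k j)) (cong ((k ℕ.+ j) C_) (ℕ.m+n∸m≡n k j)))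
        rearrange : ∀ k j d → k ℕ.+ j ℕ.+ suc d ≡ suc (k ℕ.+ d ℕ.+ j)
        rearrange = ℕ-solve-∀
        k+j+1+[i∸k]≡p : k ℕ.+ j ℕ.+ suc (i ∸ k) ≡ p
        k+j+1+[i∸k]≡p =
          trans (rearrange k j (i ∸ k)) (trans (cong (λ n → suc (n ℕ.+ j)) (ℕ.m+[n∸m]≡n k≤i)) 1+i+j≡p)

    [1-t²]^-even-diagonal-≉0 : ∀ i → i mod 2 ≡ 0 → i < p → ¬ ([1-t²]^ i) i ≈ 0ℤ
    [1-t²]^-even-diagonal-≉0 i even i<p diagonal≈0 =
      prime∤nCk prime i<p k≤i
        (≈0⇒∣ (^-*-cancelˡ-≈0 prime p∤1 k (≈-trans (≡⇒≈ (sym diagonal≡±iCk)) diagonal≈0)))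
      where
      k = i / 2
      k≤i : k ≤ i
      k≤i = subst (k ≤_) (sym (even⇒≡k*2 even)) (ℕ.m≤m*n k 2)
      diagonal≡±iCk : ([1-t²]^ i) i ≡ -1ℤ ^ k * + (i C k)
      diagonal≡±iCk = trans (cong ([1-t²]^ i) (even⇒≡k*2 even)) ([1-t²]^-even i k)
      p∤1 : ¬ p ℕ.∣ 1
      p∤1 p∣1 = ℕ.nonTrivial⇒≢1 {{prime⇒nonTrivial prime}} (ℕ.∣1⇒≡1 p∣1)

    F[-2]≈[1-t²]ⁱ : ∀ {m} → (m ℕ.+ 2) mod p ≡ 0 → ∀ i → + F p m i i ≈ ([1-t²]^ i) i
    F[-2]≈[1-t²]ⁱ {m} m+2≡0 i = F≈entry p m -1ℤ m≈-2 i i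
      where
      add-subtract : ∀ x y → x ≡ x + y - y
      add-subtract = solve-∀
      m≈-2 : + m ≈ -1ℤ - 1ℤ
      m≈-2 = begin
        + m                ≡⟨ add-subtract (+ m) (+ 2) ⟩
        + m + + 2 - + 2    ≡⟨ cong (_- + 2) (ℤ.pos-+ m 2) ⟨
        + (m ℕ.+ 2) - + 2  ≈⟨ +-cong (mod≡0⇒≈0 (m ℕ.+ 2) m+2≡0) (≈-refl { - (+ 2)}) ⟩
        -1ℤ - 1ℤ           ∎

    2ⁱ·F[-1/2]≈[1-t²]ⁱ : ∀ {m} → (2 ℕ.* m ℕ.+ 1) mod p ≡ 0 → ∀ i j → suc (i ℕ.+ j) ≡ p →
      (+ 2) ^ i * + F p m i j ≈ ([1-t²]^ i) i
    2ⁱ·F[-1/2]≈[1-t²]ⁱ {m} 2m+1≡0 i j 1+i+j≡p =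
      ≈-trans (*-congˡ ((+ 2) ^ i) (F≈entry p m (1ℤ + + m) (≡⇒≈ (x≡[1+x]-1 (+ m))) i j))
              (2ⁱ·entry≈[1-t²]ⁱ 2[1+m]≈1 i j 1+i+j≡p)
      where
      x≡[1+x]-1 : ∀ x → x ≡ (1ℤ + x) - 1ℤ
      x≡[1+x]-1 = solve-∀
      expand : ∀ x → (+ 2) * (1ℤ + x) ≡ (+ 2) * x + 1ℤ + 1ℤ
      expand = solve-∀
      2[1+m]≈1 : (+ 2) * (1ℤ + + m) ≈ 1ℤ
      2[1+m]≈1 = begin
        (+ 2) * (1ℤ + + m)      ≡⟨ expand (+ m) ⟩
        (+ 2) * + m + 1ℤ + 1ℤ   ≡⟨ cong (λ x → x + 1ℤ + 1ℤ) (ℤ.pos-* 2 m) ⟨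
        + (2 ℕ.* m) + 1ℤ + 1ℤ   ≡⟨ cong (_+ 1ℤ) (ℤ.pos-+ (2 ℕ.* m) 1) ⟨
        + (2 ℕ.* m ℕ.+ 1) + 1ℤ  ≈⟨ +-cong (mod≡0⇒≈0 (2 ℕ.* m ℕ.+ 1) 2m+1≡0) (≈-refl {1ℤ}) ⟩
        1ℤ                      ∎

    diagonal-vanishes : ∀ m → (m ℕ.+ 2) mod p ≡ 0 → ∀ i → i mod 2 ≡ 1 → F p m i i ≡ 0
    diagonal-vanishes m m+2≡0 i odd = <p∧≈0⇒≡0 (F<p {{prime⇒nonZero prime}} m i i)
      (≈-trans (F[-2]≈[1-t²]ⁱ m+2≡0 i) (≡⇒≈ ([1-t²]^-odd-diagonal i odd)))

    diagonal-nonvanishing : ∀ m → (m ℕ.+ 2) mod p ≡ 0 →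
      ∀ i → i mod 2 ≡ 0 → i < p → ¬ F p m i i ≡ 0
    diagonal-nonvanishing m m+2≡0 i even i<p F≡0 = [1-t²]^-even-diagonal-≉0 i even i<p
      (≈-trans (≈-sym (F[-2]≈[1-t²]ⁱ m+2≡0 i)) (≡⇒≈ (cong +_ F≡0)))

    antidiagonal-vanishes : 2 < p → ∀ m → (2 ℕ.* m ℕ.+ 1) mod p ≡ 0 →
      ∀ i j → i mod 2 ≡ 1 → suc (i ℕ.+ j) ≡ p → F p m i j ≡ 0
    antidiagonal-vanishes 2<p m 2m+1≡0 i j odd 1+i+j≡p = <p∧≈0⇒≡0 (F<p {{prime⇒nonZero prime}} m i j)
      (^-*-cancelˡ-≈0 prime p∤2 i
        (≈-trans (2ⁱ·F[-1/2]≈[1-t²]ⁱ 2m+1≡0 i j 1+i+j≡p) (≡⇒≈ ([1-t²]^-odd-diagonal i odd))))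
      where
      p∤2 : ¬ p ℕ.∣ 2
      p∤2 p∣2 = ℕ.<⇒≱ 2<p (ℕ.∣⇒≤ p∣2)

    antidiagonal-nonvanishing : ∀ m → (2 ℕ.* m ℕ.+ 1) mod p ≡ 0 →
      ∀ i j → i mod 2 ≡ 0 → suc (i ℕ.+ j) ≡ p → ¬ F p m i j ≡ 0
    antidiagonal-nonvanishing m 2m+1≡0 i j even 1+i+j≡p F≡0 = [1-t²]^-even-diagonal-≉0 i even i<p (begin
      ([1-t²]^ i) i            ≈⟨ 2ⁱ·F[-1/2]≈[1-t²]ⁱ 2m+1≡0 i j 1+i+j≡p ⟨
      (+ 2) ^ i * + F p m i j  ≡⟨ cong (λ n → (+ 2) ^ i * + n) F≡0 ⟩
      (+ 2) ^ i * 0ℤ           ≡⟨ ℤ.*-zeroʳ ((+ 2) ^ i) ⟩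
      0ℤ                       ∎)
      where
      i<p : i < p
      i<p = subst (i <_) 1+i+j≡p (s≤s (ℕ.m≤m+n i j))

open import Data.Nat using (ℕ; zero; suc; _+_; _*_; _∸_; _≤_; _<_; s≤s)
import Data.Nat.Properties as ℕ
open import Data.Nat.Primality using (Prime)
open import Data.Product using (_×_; _,_)
open import Relation.Binary.PropositionalEquality using (_≡_; cong)
open import Relation.Nullary using (¬_)
open IntegerModel
  using (diagonal-vanishes; diagonal-nonvanishing; antidiagonal-vanishes; antidiagonal-nonvanishing)

theorem5p4 : (p : ℕ) → Prime p → 5 ≤ p →
    (mA mB : ℕ) → mA < p → (mA + 2) mod p ≡ 0 → mB < p → (2 * mB + 1) mod p ≡ 0 →
      (∀ i → i mod 2 ≡ 1 → 0 < i → i < p ∸ 1 → F p mA i i ≡ 0)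
    × (∀ i → i mod 2 ≡ 1 → 0 < i → i < p ∸ 1 → F p mB i (p ∸ 1 ∸ i) ≡ 0)
    × (∀ i → i mod 2 ≡ 0 → i ≤ p ∸ 1 → ¬ (F p mA i i ≡ 0) × ¬ (F p mB i (p ∸ 1 ∸ i) ≡ 0))
theorem5p4 zero _ ()
theorem5p4 (suc q) isPrime 5≤p mA mB _ mA+2≡0 _ 2mB+1≡0 =
    (λ i odd _ _ → diagonal-vanishes isPrime mA mA+2≡0 i odd)
  , (λ i odd _ i<q → antidiagonal-vanishes isPrime 2<p mB 2mB+1≡0 i (q ∸ i) odd (complement (ℕ.<⇒≤ i<q)))
  , (λ i even i≤q → diagonal-nonvanishing isPrime mA mA+2≡0 i even (s≤s i≤q)
                  , antidiagonal-nonvanishing isPrime mB 2mB+1≡0 i (q ∸ i) even (complement i≤q))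
  where
  2<p : 2 < suc q
  2<p = ℕ.≤-trans (ℕ.m≤m+n 3 2) 5≤p
  complement : ∀ {i} → i ≤ q → suc (i + (q ∸ i)) ≡ suc q
  complement i≤q = cong suc (ℕ.m+[n∸m]≡n i≤q)
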